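{- Let $G$ be a connected graph and $H$ a graph, both with at least two vertices. Then $G[H]$ is well-dominated if and only if either (i) $G$ is well-dominated and $H$ is complete, or (ii) $G$ is complete and $H$ is well-dominated with $\gamma(H)=2$.
   Context: A graph is well-dominated if all its inclusion-minimal dominating sets have the same size. $\gamma$ is the domination number. The lexicographic product $G[H]$ has vertex set $V(G)\times V(H)$, with $(x_1,y_1)$ adjacent to $(x_2,y_2)$ iff $x_1x_2\in E(G)$, or $x_1=x_2$ and $y_1y_2\in E(H)$. -}

module Defs where

open import Data.Nat using (ℕ; _*_; _≤_)
open import Data.Fin using (Fin; remQuot; _≟_)
open import Data.Fin.Subset using (Subset; _∈_; _⊂_; ∣_∣)
open import Data.Bool using (Bool; true; false; _∨_; _∧_)
open import Data.Product using (Σ; _×_; _,_; ∃; ∃-syntax)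
open import Data.Sum using (_⊎_)
open import Relation.Binary.PropositionalEquality using (_≡_; _≢_)
open import Relation.Nullary using (¬_)
open import Relation.Nullary.Decidable using (⌊_⌋)

record Graph : Set where
  field
    order : ℕ
    adj   : Fin order → Fin order → Bool
open Graph public

IsSimple : Graph → Set
IsSimple G = (∀ u v → adj G u v ≡ adj G v u) × (∀ v → adj G v v ≡ false)

Complete : Graph → Set
Complete G = ∀ u v → u ≢ v → adj G u v ≡ true

data Reachable (G : Graph) : Fin (order G) → Fin (order G) → Set where
  here  : ∀ {u} → Reachable G u u
  step  : ∀ {u v w} → adj G u v ≡ true → Reachable G v w → Reachable G u w

Connected : Graph → Set
Connected G = ∀ u v → Reachable G u v

Dominating : (G : Graph) → Subset (order G) → Set
Dominating G S = ∀ v → v ∈ S ⊎ (∃[ u ] (u ∈ S × adj G u v ≡ true))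

MinimalDominating : (G : Graph) → Subset (order G) → Set
MinimalDominating G S = Dominating G S × (∀ T → T ⊂ S → ¬ Dominating G T)

WellDominated : Graph → Set
WellDominated G = ∀ S T → MinimalDominating G S → MinimalDominating G T → ∣ S ∣ ≡ ∣ T ∣

DominationNumber : Graph → ℕ → Set
DominationNumber G k =
  (∃[ S ] (Dominating G S × ∣ S ∣ ≡ k)) × (∀ S → Dominating G S → k ≤ ∣ S ∣)

-- Lexicographic product G[H]; vertex i of Fin (order G * order H) is the pair remQuot i.
lex : Graph → Graph → Graph
lex G H = record { order = order G * order H ; adj = a }
  where
    a : Fin (order G * order H) → Fin (order G * order H) → Bool
    a i j with remQuot {order G} (order H) i | remQuot {order G} (order H) j
    ... | (x₁ , y₁) | (x₂ , y₂) = adj G x₁ x₂ ∨ (⌊ x₁ ≟ x₂ ⌋ ∧ adj H y₁ y₂)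

-- If H is complete, every fibre {x} × V(H) of G[H] acts like the single vertex x: a minimal
-- dominating set of G[H] meets each fibre at most once and projects onto a minimal dominating
-- set of G of the same size, while a minimal dominating set D of G lifts to D × {y}; so G[H] is
-- well-dominated exactly when G is.
-- If H is not complete, fix distinct non-adjacent y₁, y₂. Were G not complete, connectivity
-- would give an induced path a – z – w, and for maximal independent sets I ∋ a, w of G and
-- J ∋ y₁, y₂ of H the minimal dominating set I × J could trade (a, y₂), (w, y₂) for (z, y₁),
-- contradicting well-domination. So G is complete; then a minimal dominating set of G[H] is
-- either a pair meeting two fibres or {x} × A with A minimal dominating in H, and the pair
-- {(x₀, y₁), (x₁, y₁)} is minimal dominating. Hence G[H] is well-dominated if and only if
-- every minimal dominating set of H has two vertices, i.e. H is well-dominated with γ(H) = 2.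

module Submission where

import Data.Bool as Bool
open import Data.Bool using (true; false; _∧_)
open import Data.Bool.Properties using (∨-zeroʳ; ¬-not)
open import Data.Empty using (⊥-elim)
open import Data.Fin using (Fin; zero; suc; _≟_; combine; remQuot)
open import Data.Fin.Properties
  using (any?; all?; suc-injective; combine-injectiveˡ; combine-injectiveʳ; remQuot-combine; combine-remQuot)
open import Data.Fin.Subset
  using (Subset; inside; outside; ⁅_⁆; _∈_; _∉_; _⊆_; _⊂_; _∪_; _∩_; _-_; ∣_∣; Nonempty)
  renaming (⊥ to ∅; ⊤ to full)
open import Data.Fin.Subset.Properties
  using (_∈?_; ∉⊥; ∈⊤; ∣⊥∣≡0; x∈⁅x⁆; x∈⁅y⁆⇒x≡y; ∣⁅x⁆∣≡1; x∈p∪q⁺; x∈p∪q⁻; p⊆p∪q; q⊆p∪q;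
         x∈p∩q⁺; x∈p∩q⁻; p∩q⊆p; p─q⊆p; x∈p∧x≢y⇒x∈p-y; x∈p⇒p-x⊂p; x∈p⇒∣p-x∣<∣p∣;
         p⊆q⇒∣p∣≤∣q∣; p⊂q⇒∣p∣<∣q∣; ∣p∣≤n; ⊆-antisym)
open import Data.Nat using (ℕ; suc; _+_; _*_; _∸_; _≤_; _<_; s≤s)
open import Data.Nat.Induction using (<-wellFounded)
open import Data.Nat.Properties
  using (+-comm; +-suc; +-identityʳ; *-identityʳ; <⇒≱; ≤-antisym; ∸-monoʳ-<; module ≤-Reasoning)
open import Data.Product using (Σ; _×_; _,_; proj₁; proj₂; ∃-syntax)
open import Data.Sum using (_⊎_; inj₁; inj₂; [_,_]′)
open import Data.Vec using ([]; _∷_; here; there; _++_; lookup; tabulate)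
open import Data.Vec.Properties
  using (lookup-++ˡ; lookup-++ʳ; lookup-replicate; lookup∘tabulate; []=⇒lookup; lookup⇒[]=)
open import Function using (_∘_; id; case_of_)
open import Function.Bundles using (_⇔_; mk⇔; Equivalence)
open import Induction.WellFounded using (Acc; acc)
open import Relation.Binary.PropositionalEquality
  using (_≡_; _≢_; refl; sym; trans; cong; cong₂; subst; subst₂; module ≡-Reasoning)
open import Relation.Nullary using (¬_; Dec; yes; no; ¬?)
open import Relation.Nullary.Decidable using (_×-dec_; _⊎-dec_; _→-dec_)

open import Defs

true≢false : true ≢ false
true≢false ()

-- Subsets of finite sets

∣p++q∣≡∣p∣+∣q∣ : ∀ {m n} (p : Subset m) (q : Subset n) → ∣ p ++ q ∣ ≡ ∣ p ∣ + ∣ q ∣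
∣p++q∣≡∣p∣+∣q∣ []            q = refl
∣p++q∣≡∣p∣+∣q∣ (inside  ∷ p) q = cong suc (∣p++q∣≡∣p∣+∣q∣ p q)
∣p++q∣≡∣p∣+∣q∣ (outside ∷ p) q = ∣p++q∣≡∣p∣+∣q∣ p q

∣p∪q∣≡∣p∣+∣q∣ : ∀ {n} (p q : Subset n) → (∀ {x} → x ∈ p → x ∉ q) → ∣ p ∪ q ∣ ≡ ∣ p ∣ + ∣ q ∣
∣p∪q∣≡∣p∣+∣q∣ []            []            _        = refl
∣p∪q∣≡∣p∣+∣q∣ (inside  ∷ p) (inside  ∷ q) disjoint = ⊥-elim (disjoint here here)
∣p∪q∣≡∣p∣+∣q∣ (inside  ∷ p) (outside ∷ q) disjoint =
  cong suc (∣p∪q∣≡∣p∣+∣q∣ p q (λ x∈p x∈q → disjoint (there x∈p) (there x∈q)))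
∣p∪q∣≡∣p∣+∣q∣ (outside ∷ p) (inside  ∷ q) disjoint =
  trans (cong suc (∣p∪q∣≡∣p∣+∣q∣ p q (λ x∈p x∈q → disjoint (there x∈p) (there x∈q))))
        (sym (+-suc ∣ p ∣ ∣ q ∣))
∣p∪q∣≡∣p∣+∣q∣ (outside ∷ p) (outside ∷ q) disjoint =
  ∣p∪q∣≡∣p∣+∣q∣ p q (λ x∈p x∈q → disjoint (there x∈p) (there x∈q))

x,y∈⁅z⁆⇒x≡y : ∀ {n} {x y z : Fin n} → x ∈ ⁅ z ⁆ → y ∈ ⁅ z ⁆ → x ≡ y
x,y∈⁅z⁆⇒x≡y {z = z} x∈ y∈ = trans (x∈⁅y⁆⇒x≡y z x∈) (sym (x∈⁅y⁆⇒x≡y z y∈))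

∣⁅x⁆∪⁅y⁆∣≡2 : ∀ {n} {x y : Fin n} → x ≢ y → ∣ ⁅ x ⁆ ∪ ⁅ y ⁆ ∣ ≡ 2
∣⁅x⁆∪⁅y⁆∣≡2 {x = x} {y} x≢y =
  trans (∣p∪q∣≡∣p∣+∣q∣ ⁅ x ⁆ ⁅ y ⁆ disjoint) (cong₂ _+_ (∣⁅x⁆∣≡1 x) (∣⁅x⁆∣≡1 y))
  where
  disjoint : ∀ {z} → z ∈ ⁅ x ⁆ → z ∉ ⁅ y ⁆
  disjoint z∈x z∈y = x≢y (trans (x,y∈⁅z⁆⇒x≡y (x∈⁅x⁆ x) z∈x) (x∈⁅y⁆⇒x≡y y z∈y))

∣p-x-y∪⁅z⁆∣<∣p∣ : ∀ {n} {p : Subset n} {x y z} → x ∈ p → y ∈ p → y ≢ x → z ∉ p →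
                  ∣ (p - x - y) ∪ ⁅ z ⁆ ∣ < ∣ p ∣
∣p-x-y∪⁅z⁆∣<∣p∣ {p = p} {x} {y} {z} x∈p y∈p y≢x z∉p = begin-strict
  ∣ (p - x - y) ∪ ⁅ z ⁆ ∣     ≡⟨ ∣p∪q∣≡∣p∣+∣q∣ (p - x - y) ⁅ z ⁆ disjoint ⟩
  ∣ p - x - y ∣ + ∣ ⁅ z ⁆ ∣ ≡⟨ cong (∣ p - x - y ∣ +_) (∣⁅x⁆∣≡1 z) ⟩
  ∣ p - x - y ∣ + 1         ≡⟨ +-comm ∣ p - x - y ∣ 1 ⟩
  suc ∣ p - x - y ∣         ≤⟨ x∈p⇒∣p-x∣<∣p∣ (x∈p∧x≢y⇒x∈p-y y∈p y≢x) ⟩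
  ∣ p - x ∣                 <⟨ x∈p⇒∣p-x∣<∣p∣ x∈p ⟩
  ∣ p ∣                     ∎
  where
  open ≤-Reasoning
  disjoint : ∀ {w} → w ∈ p - x - y → w ∉ ⁅ z ⁆
  disjoint w∈ w∈z with x∈⁅y⁆⇒x≡y z w∈z
  ... | refl = z∉p (p─q⊆p p ⁅ x ⁆ (p─q⊆p (p - x) ⁅ y ⁆ w∈))

⊂⁅x⁆∪⁅y⁆ : ∀ {n} {t : Subset n} {x y} → t ⊂ ⁅ x ⁆ ∪ ⁅ y ⁆ → t ⊆ ⁅ x ⁆ ⊎ t ⊆ ⁅ y ⁆
⊂⁅x⁆∪⁅y⁆ {t = t} {x} {y} (t⊆ , k , k∈ , k∉t) with x∈p∪q⁻ ⁅ x ⁆ ⁅ y ⁆ k∈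
... | inj₁ k∈x = inj₂ λ w∈t → [ (λ w∈x → ⊥-elim (k∉t (subst (_∈ t) (x,y∈⁅z⁆⇒x≡y w∈x k∈x) w∈t))) , id ]′
                                (x∈p∪q⁻ ⁅ x ⁆ ⁅ y ⁆ (t⊆ w∈t))
... | inj₂ k∈y = inj₁ λ w∈t → [ id , (λ w∈y → ⊥-elim (k∉t (subst (_∈ t) (x,y∈⁅z⁆⇒x≡y w∈y k∈y) w∈t))) ]′
                                (x∈p∪q⁻ ⁅ x ⁆ ⁅ y ⁆ (t⊆ w∈t))

⁅x⁆∪⁅y⁆⊆p : ∀ {n} {p : Subset n} {x y} → x ∈ p → y ∈ p → ⁅ x ⁆ ∪ ⁅ y ⁆ ⊆ p
⁅x⁆∪⁅y⁆⊆p {p = p} {x} {y} x∈p y∈p z∈ with x∈p∪q⁻ ⁅ x ⁆ ⁅ y ⁆ z∈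
... | inj₁ z∈x = subst (_∈ p) (sym (x∈⁅y⁆⇒x≡y x z∈x)) x∈p
... | inj₂ z∈y = subst (_∈ p) (sym (x∈⁅y⁆⇒x≡y y z∈y)) y∈p

image : ∀ {m n} → (Fin m → Fin n) → Subset m → Subset n
image f []            = ∅
image f (outside ∷ p) = image (f ∘ suc) p
image f (inside  ∷ p) = ⁅ f zero ⁆ ∪ image (f ∘ suc) p

∈-image⁺ : ∀ {m n} (f : Fin m → Fin n) {p x} → x ∈ p → f x ∈ image f p
∈-image⁺ f {inside  ∷ p} here        = x∈p∪q⁺ (inj₁ (x∈⁅x⁆ (f zero)))
∈-image⁺ f {inside  ∷ p} (there x∈p) = x∈p∪q⁺ (inj₂ (∈-image⁺ (f ∘ suc) x∈p))
∈-image⁺ f {outside ∷ p} (there x∈p) = ∈-image⁺ (f ∘ suc) x∈p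

∈-image⁻ : ∀ {m n} (f : Fin m → Fin n) p {y} → y ∈ image f p → ∃[ x ] (x ∈ p × f x ≡ y)
∈-image⁻ f []            y∈ = ⊥-elim (∉⊥ y∈)
∈-image⁻ f (outside ∷ p) y∈ with ∈-image⁻ (f ∘ suc) p y∈
... | x , x∈p , fx≡y = suc x , there x∈p , fx≡y
∈-image⁻ f (inside  ∷ p) y∈ with x∈p∪q⁻ ⁅ f zero ⁆ (image (f ∘ suc) p) y∈
... | inj₁ y∈f0 = zero , here , sym (x∈⁅y⁆⇒x≡y (f zero) y∈f0)
... | inj₂ y∈fp with ∈-image⁻ (f ∘ suc) p y∈fp
...   | x , x∈p , fx≡y = suc x , there x∈p , fx≡y

InjectiveOn : ∀ {m n} → (Fin m → Fin n) → Subset m → Set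
InjectiveOn f p = ∀ {x y} → x ∈ p → y ∈ p → f x ≡ f y → x ≡ y

injectiveOn-tail : ∀ {m n} {f : Fin (suc m) → Fin n} {b p} → InjectiveOn f (b ∷ p) →
                   InjectiveOn (f ∘ suc) p
injectiveOn-tail inj x∈p y∈p e = suc-injective (inj (there x∈p) (there y∈p) e)

∣image∣≡∣p∣ : ∀ {m n} (f : Fin m → Fin n) p → InjectiveOn f p → ∣ image f p ∣ ≡ ∣ p ∣
∣image∣≡∣p∣ {n = n} f []            _   = ∣⊥∣≡0 n
∣image∣≡∣p∣         f (outside ∷ p) inj = ∣image∣≡∣p∣ (f ∘ suc) p (injectiveOn-tail inj)
∣image∣≡∣p∣         f (inside  ∷ p) inj = begin
  ∣ ⁅ f zero ⁆ ∪ image (f ∘ suc) p ∣     ≡⟨ ∣p∪q∣≡∣p∣+∣q∣ ⁅ f zero ⁆ (image (f ∘ suc) p) fresh ⟩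
  ∣ ⁅ f zero ⁆ ∣ + ∣ image (f ∘ suc) p ∣ ≡⟨ cong₂ _+_ (∣⁅x⁆∣≡1 (f zero))
                                                      (∣image∣≡∣p∣ (f ∘ suc) p (injectiveOn-tail inj)) ⟩
  suc ∣ p ∣                             ∎
  where
  open ≡-Reasoning
  fresh : ∀ {y} → y ∈ ⁅ f zero ⁆ → y ∉ image (f ∘ suc) p
  fresh y∈f0 y∈fp with ∈-image⁻ (f ∘ suc) p y∈fp
  ... | x , x∈p , fx≡y with inj (there x∈p) here (trans fx≡y (x∈⁅y⁆⇒x≡y (f zero) y∈f0))
  ...   | ()

preimage : ∀ {m n} → (Fin m → Fin n) → Subset n → Subset m
preimage f q = tabulate (lookup q ∘ f)

∈-preimage⁺ : ∀ {m n} (f : Fin m → Fin n) {q x} → f x ∈ q → x ∈ preimage f q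
∈-preimage⁺ f {q} {x} fx∈q =
  lookup⇒[]= x (preimage f q) (trans (lookup∘tabulate (lookup q ∘ f) x) ([]=⇒lookup fx∈q))

∈-preimage⁻ : ∀ {m n} (f : Fin m → Fin n) {q x} → x ∈ preimage f q → f x ∈ q
∈-preimage⁻ f {q} {x} x∈ =
  lookup⇒[]= (f x) q (trans (sym (lookup∘tabulate (lookup q ∘ f) x)) ([]=⇒lookup x∈))

-- The product set p × q, indexed by combine : Fin m → Fin n → Fin (m * n).

infixr 7 _⊗_

_⊗_ : ∀ {m n} → Subset m → Subset n → Subset (m * n)
[]            ⊗ q = []
(inside  ∷ p) ⊗ q = q ++ p ⊗ q
(outside ∷ p) ⊗ q = ∅ ++ p ⊗ q

lookup-⊗ : ∀ {m n} (p : Subset m) (q : Subset n) x y →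
           lookup (p ⊗ q) (combine x y) ≡ lookup p x ∧ lookup q y
lookup-⊗ (inside  ∷ p) q zero    y = lookup-++ˡ q (p ⊗ q) y
lookup-⊗ (outside ∷ p) q zero    y = trans (lookup-++ˡ ∅ (p ⊗ q) y) (lookup-replicate y outside)
lookup-⊗ (inside  ∷ p) q (suc x) y = trans (lookup-++ʳ q (p ⊗ q) (combine x y)) (lookup-⊗ p q x y)
lookup-⊗ {n = n} (outside ∷ p) q (suc x) y =
  trans (lookup-++ʳ (∅ {n}) (p ⊗ q) (combine x y)) (lookup-⊗ p q x y)

combine-∈-⊗⁺ : ∀ {m n} {p : Subset m} {q : Subset n} {x y} → x ∈ p → y ∈ q → combine x y ∈ p ⊗ q
combine-∈-⊗⁺ {p = p} {q} {x} {y} x∈p y∈q = lookup⇒[]= (combine x y) (p ⊗ q)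
  (trans (lookup-⊗ p q x y) (cong₂ _∧_ ([]=⇒lookup x∈p) ([]=⇒lookup y∈q)))

combine-∈-⊗⁻ : ∀ {m n} (p : Subset m) (q : Subset n) {x y} → combine x y ∈ p ⊗ q → x ∈ p × y ∈ q
combine-∈-⊗⁻ p q {x} {y} xy∈ = split (trans (sym (lookup-⊗ p q x y)) ([]=⇒lookup xy∈))
  where
  split : lookup p x ∧ lookup q y ≡ true → x ∈ p × y ∈ q
  split e with lookup p x in px | lookup q y in qy
  split refl | true | true = lookup⇒[]= x p px , lookup⇒[]= y q qy

∣p⊗q∣≡∣p∣*∣q∣ : ∀ {m n} (p : Subset m) (q : Subset n) → ∣ p ⊗ q ∣ ≡ ∣ p ∣ * ∣ q ∣
∣p⊗q∣≡∣p∣*∣q∣ []            q = refl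
∣p⊗q∣≡∣p∣*∣q∣ (inside  ∷ p) q =
  trans (∣p++q∣≡∣p∣+∣q∣ q (p ⊗ q)) (cong (∣ q ∣ +_) (∣p⊗q∣≡∣p∣*∣q∣ p q))
∣p⊗q∣≡∣p∣*∣q∣ {n = n} (outside ∷ p) q =
  trans (∣p++q∣≡∣p∣+∣q∣ (∅ {n}) (p ⊗ q)) (cong₂ _+_ (∣⊥∣≡0 n) (∣p⊗q∣≡∣p∣*∣q∣ p q))

∣p⊗⁅y⁆∣≡∣p∣ : ∀ {m n} (p : Subset m) (y : Fin n) → ∣ p ⊗ ⁅ y ⁆ ∣ ≡ ∣ p ∣
∣p⊗⁅y⁆∣≡∣p∣ p y =
  trans (∣p⊗q∣≡∣p∣*∣q∣ p ⁅ y ⁆) (trans (cong (∣ p ∣ *_) (∣⁅x⁆∣≡1 y)) (*-identityʳ ∣ p ∣))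

∣⁅x⁆⊗q∣≡∣q∣ : ∀ {m n} (x : Fin m) (q : Subset n) → ∣ ⁅ x ⁆ ⊗ q ∣ ≡ ∣ q ∣
∣⁅x⁆⊗q∣≡∣q∣ x q =
  trans (∣p⊗q∣≡∣p∣*∣q∣ ⁅ x ⁆ q) (trans (cong (_* ∣ q ∣) (∣⁅x⁆∣≡1 x)) (+-identityʳ ∣ q ∣))

distinct-elements : ∀ {n} → 2 ≤ n → Σ (Fin n) λ x → Σ (Fin n) λ y → x ≢ y
distinct-elements (s≤s (s≤s _)) = zero , suc zero , λ ()

-- Domination

Dominates : (K : Graph) → Subset (order K) → Fin (order K) → Set
Dominates K S v = v ∈ S ⊎ ∃[ u ] (u ∈ S × adj K u v ≡ true)

Independent : (K : Graph) → Subset (order K) → Set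
Independent K S = ∀ {u v} → u ∈ S → v ∈ S → adj K u v ≡ false

MinimalDominatingSize : Graph → ℕ → Set
MinimalDominatingSize K k = ∀ S → MinimalDominating K S → ∣ S ∣ ≡ k

module _ (K : Graph) where

  dominates-via : ∀ {S u v} → u ∈ S → u ≡ v ⊎ adj K u v ≡ true → Dominates K S v
  dominates-via u∈S (inj₁ refl) = inj₁ u∈S
  dominates-via u∈S (inj₂ u~v)  = inj₂ (_ , u∈S , u~v)

  dominates⁻ : ∀ {S v} → Dominates K S v → ∃[ u ] (u ∈ S × (u ≡ v ⊎ adj K u v ≡ true))
  dominates⁻ (inj₁ v∈S)              = _ , v∈S , inj₁ refl
  dominates⁻ (inj₂ (u , u∈S , u~v)) = u , u∈S , inj₂ u~v

  dominates⇒nonempty : ∀ {S v} → Dominates K S v → Nonempty S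
  dominates⇒nonempty d = let u , u∈S , _ = dominates⁻ d in u , u∈S

  dominating-mono : ∀ {S T} → S ⊆ T → Dominating K S → Dominating K T
  dominating-mono S⊆T dS v = let u , u∈S , u-v = dominates⁻ (dS v) in dominates-via (S⊆T u∈S) u-v

  dominating? : ∀ S → Dec (Dominating K S)
  dominating? S = all? λ v → v ∈? S ⊎-dec any? λ u → u ∈? S ×-dec adj K u v Bool.≟ true

  minimalDominating-by-removal : ∀ {S} → Dominating K S → (∀ {s} → s ∈ S → ¬ Dominating K (S - s)) →
                                MinimalDominating K S
  minimalDominating-by-removal {S} dS irredundant = dS , λ where
    T (T⊆S , s , s∈S , s∉T) dT →
      irredundant s∈S (dominating-mono (λ t∈T → x∈p∧x≢y⇒x∈p-y (T⊆S t∈T) λ { refl → s∉T t∈T }) dT)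

  minimalDominating-⊆ : ∀ S → Dominating K S → ∃[ M ] (MinimalDominating K M × M ⊆ S)
  minimalDominating-⊆ S = go S (<-wellFounded ∣ S ∣)
    where
    go : ∀ S → Acc _<_ ∣ S ∣ → Dominating K S → ∃[ M ] (MinimalDominating K M × M ⊆ S)
    go S (acc smaller) dS with any? (λ s → s ∈? S ×-dec dominating? (S - s))
    ... | yes (s , s∈S , dS-s) =
      let M , mM , M⊆S-s = go (S - s) (smaller (x∈p⇒∣p-x∣<∣p∣ s∈S)) dS-s
      in M , mM , λ m∈M → p─q⊆p S ⁅ s ⁆ (M⊆S-s m∈M)
    ... | no irredundant =
      S , minimalDominating-by-removal dS (λ s∈S dS-s → irredundant (_ , s∈S , dS-s)) , id

  minimalDominating-irreducible : ∀ {S T} → MinimalDominating K S → T ⊆ S → Dominating K T → S ⊆ T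
  minimalDominating-irreducible {T = T} (_ , minimal) T⊆S dT {x} x∈S with x ∈? T
  ... | yes x∈T = x∈T
  ... | no  x∉T = ⊥-elim (minimal T (T⊆S , x , x∈S , x∉T) dT)

  independent-dominating⇒minimal : ∀ {S} → Independent K S → Dominating K S → MinimalDominating K S
  independent-dominating⇒minimal independent dS = dS , λ where
    T (T⊆S , s , s∈S , s∉T) dT → case dT s of λ where
      (inj₁ s∈T)              → s∉T s∈T
      (inj₂ (u , u∈T , u~s)) → true≢false (trans (sym u~s) (independent (T⊆S u∈T) s∈S))

  independent-∪⁅⁆ : ∀ {A v} → IsSimple K → Independent K A → (∀ {u} → u ∈ A → adj K u v ≡ false) →
                    Independent K (A ∪ ⁅ v ⁆)
  independent-∪⁅⁆ {A} {v} (symmetric , loopless) independent v-free a∈ b∈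
    with x∈p∪q⁻ A ⁅ v ⁆ a∈ | x∈p∪q⁻ A ⁅ v ⁆ b∈
  ... | inj₁ a∈A | inj₁ b∈A = independent a∈A b∈A
  ... | inj₁ a∈A | inj₂ b∈v rewrite x∈⁅y⁆⇒x≡y v b∈v = v-free a∈A
  ... | inj₂ a∈v | inj₁ b∈A rewrite x∈⁅y⁆⇒x≡y v a∈v = trans (symmetric v _) (v-free b∈A)
  ... | inj₂ a∈v | inj₂ b∈v rewrite x∈⁅y⁆⇒x≡y v a∈v | x∈⁅y⁆⇒x≡y v b∈v = loopless v

  independent-⁅⁆∪⁅⁆ : ∀ {a b} → IsSimple K → adj K a b ≡ false → Independent K (⁅ a ⁆ ∪ ⁅ b ⁆)
  independent-⁅⁆∪⁅⁆ {a} simple@(_ , loopless) a≁b = independent-∪⁅⁆ simple single λ u∈a →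
    subst (λ u → adj K u _ ≡ false) (sym (x∈⁅y⁆⇒x≡y a u∈a)) a≁b
    where
    single : Independent K ⁅ a ⁆
    single u∈a v∈a rewrite x∈⁅y⁆⇒x≡y a u∈a | x∈⁅y⁆⇒x≡y a v∈a = loopless a

  maximalIndependent-⊇ : ∀ {A} → IsSimple K → Independent K A →
                         ∃[ I ] (A ⊆ I × Independent K I × Dominating K I)
  maximalIndependent-⊇ {A} simple = go A (<-wellFounded (order K ∸ ∣ A ∣))
    where
    go : ∀ A → Acc _<_ (order K ∸ ∣ A ∣) → Independent K A →
         ∃[ I ] (A ⊆ I × Independent K I × Dominating K I)
    go A (acc smaller) independent
      with any? (λ v → ¬? (v ∈? A) ×-dec all? λ u → u ∈? A →-dec adj K u v Bool.≟ false)
    ... | yes (v , v∉A , v-free) =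
      let I , A∪v⊆I , independent-I , dI = go (A ∪ ⁅ v ⁆)
            (smaller (∸-monoʳ-< (p⊂q⇒∣p∣<∣q∣ A⊂A∪v) (∣p∣≤n (A ∪ ⁅ v ⁆))))
            (independent-∪⁅⁆ simple independent (v-free _))
      in I , (λ a∈A → A∪v⊆I (p⊆p∪q ⁅ v ⁆ a∈A)) , independent-I , dI
      where
      A⊂A∪v : A ⊂ A ∪ ⁅ v ⁆
      A⊂A∪v = p⊆p∪q ⁅ v ⁆ , v , q⊆p∪q A ⁅ v ⁆ (x∈⁅x⁆ v) , v∉A
    ... | no maximal = A , id , independent , dominated
      where
      dominated : Dominating K A
      dominated v with v ∈? A | any? (λ u → u ∈? A ×-dec adj K u v Bool.≟ true)
      ... | yes v∈A | _          = inj₁ v∈A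
      ... | no  _   | yes u~v    = inj₂ u~v
      ... | no  v∉A | no  none~v =
        ⊥-elim (maximal (v , v∉A , λ u u∈A → ¬-not λ u~v → none~v (u , u∈A , u~v)))

  -- Walk from a to v while staying in the closed neighbourhood of a; the first step that
  -- leaves it goes from a neighbour z of a to some w at distance two.
  distance-two : Connected K → ∀ {a v} → a ≢ v → adj K a v ≡ false →
                 ∃[ z ] ∃[ w ] (adj K a z ≡ true × adj K z w ≡ true × a ≢ w × adj K a w ≡ false)
  distance-two connected {a} {v} a≢v a≁v = along (connected a v) (inj₁ refl)
    where
    along : ∀ {u} → Reachable K u v → a ≡ u ⊎ adj K a u ≡ true →
            ∃[ z ] ∃[ w ] (adj K a z ≡ true × adj K z w ≡ true × a ≢ w × adj K a w ≡ false)
    along here             (inj₁ refl) = ⊥-elim (a≢v refl)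
    along here             (inj₂ a~v)  = ⊥-elim (true≢false (trans (sym a~v) a≁v))
    along (step {v = u′} u~u′ walk) a-u with a ≟ u′ | adj K a u′ in a-u′
    ... | yes refl | _     = along walk (inj₁ refl)
    ... | no  _    | true  = along walk (inj₂ a-u′)
    ... | no  a≢u′ | false with a-u
    ...   | inj₁ refl = ⊥-elim (true≢false (trans (sym u~u′) a-u′))
    ...   | inj₂ a~u  = _ , u′ , a~u , u~u′ , a≢u′ , a-u′

  complete⊎nonadjacent : Complete K ⊎ ∃[ y ] ∃[ y′ ] (y ≢ y′ × adj K y y′ ≡ false)
  complete⊎nonadjacent with any? (λ y → any? λ y′ → ¬? (y ≟ y′) ×-dec adj K y y′ Bool.≟ false)
  ... | yes nonadjacent = inj₂ nonadjacent
  ... | no  none        = inj₁ λ y y′ y≢y′ → ¬-not λ y≁y′ → none (y , y′ , y≢y′ , y≁y′)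

  minimalDominatingSize⇒wellDominated : ∀ {k} → MinimalDominatingSize K k → WellDominated K
  minimalDominatingSize⇒wellDominated size S T mS mT = trans (size S mS) (sym (size T mT))

  minimalDominatingSize⇒dominationNumber : ∀ {k} → MinimalDominatingSize K k → DominationNumber K k
  minimalDominatingSize⇒dominationNumber size =
    let M , mM , _ = minimalDominating-⊆ full (λ _ → inj₁ ∈⊤) in
    (M , proj₁ mM , size M mM) , λ S dS →
      let M′ , mM′ , M′⊆S = minimalDominating-⊆ S dS
      in subst (_≤ ∣ S ∣) (size M′ mM′) (p⊆q⇒∣p∣≤∣q∣ M′⊆S)

  wellDominated⇒minimal-minimum : WellDominated K → ∀ {S X} → MinimalDominating K S → Dominating K X →
                                  ∣ S ∣ ≤ ∣ X ∣
  wellDominated⇒minimal-minimum wd {S} {X} mS dX =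
    let M , mM , M⊆X = minimalDominating-⊆ X dX
    in subst (_≤ ∣ X ∣) (wd M S mM mS) (p⊆q⇒∣p∣≤∣q∣ M⊆X)

  wellDominated⇒minimalDominatingSize : ∀ {k} → WellDominated K → DominationNumber K k →
                                        MinimalDominatingSize K k
  wellDominated⇒minimalDominatingSize wd ((D , dD , ∣D∣≡k) , k≤) S mS =
    ≤-antisym (subst (∣ S ∣ ≤_) ∣D∣≡k (wellDominated⇒minimal-minimum wd mS dD)) (k≤ S (proj₁ mS))

-- The lexicographic product

module LexicographicProduct (G H : Graph) where

  L : Graph
  L = lex G H

  π₁ : Fin (order L) → Fin (order G)
  π₁ i = proj₁ (remQuot {order G} (order H) i)

  π₂ : Fin (order L) → Fin (order H)
  π₂ i = proj₂ (remQuot {order G} (order H) i)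

  ⟪_,_⟫ : Fin (order G) → Fin (order H) → Fin (order L)
  ⟪ x , y ⟫ = combine x y

  π₁-⟪⟫ : ∀ {x y} → π₁ ⟪ x , y ⟫ ≡ x
  π₁-⟪⟫ {x} {y} = cong proj₁ (remQuot-combine x y)

  π₂-⟪⟫ : ∀ {x y} → π₂ ⟪ x , y ⟫ ≡ y
  π₂-⟪⟫ {x} {y} = cong proj₂ (remQuot-combine x y)

  ⟪π₁,π₂⟫ : ∀ {u x} → π₁ u ≡ x → ⟪ x , π₂ u ⟫ ≡ u
  ⟪π₁,π₂⟫ {u} refl = combine-remQuot {order G} (order H) u

  π-injective : ∀ {u v} → π₁ u ≡ π₁ v → π₂ u ≡ π₂ v → u ≡ v
  π-injective {u} {v} π₁u≡π₁v π₂u≡π₂v =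
    trans (sym (⟪π₁,π₂⟫ refl)) (trans (cong₂ ⟪_,_⟫ π₁u≡π₁v π₂u≡π₂v) (⟪π₁,π₂⟫ refl))

  ∈-⊗⁺ : ∀ {D A x y} → x ∈ D → y ∈ A → ⟪ x , y ⟫ ∈ D ⊗ A
  ∈-⊗⁺ = combine-∈-⊗⁺

  ∈-⊗⁻ : ∀ D A {u} → u ∈ D ⊗ A → π₁ u ∈ D × π₂ u ∈ A
  ∈-⊗⁻ D A {u} u∈ = combine-∈-⊗⁻ D A (subst (_∈ D ⊗ A) (sym (⟪π₁,π₂⟫ refl)) u∈)

  adj-π₁ : ∀ {u v x} → π₁ u ≡ x → adj G x (π₁ v) ≡ true → adj L u v ≡ true
  adj-π₁ refl x~v rewrite x~v = refl

  adj-π₂ : ∀ {u v y} → π₁ u ≡ π₁ v → π₂ u ≡ y → adj H y (π₂ v) ≡ true → adj L u v ≡ true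
  adj-π₂ {u} {v} same refl y~v with π₁ u ≟ π₁ v
  ... | yes _ rewrite y~v = ∨-zeroʳ (adj G (π₁ u) (π₁ v))
  ... | no  π₁u≢π₁v = ⊥-elim (π₁u≢π₁v same)

  adj⁻ : ∀ {u v} → adj L u v ≡ true →
         adj G (π₁ u) (π₁ v) ≡ true ⊎ (π₁ u ≡ π₁ v × adj H (π₂ u) (π₂ v) ≡ true)
  adj⁻ {u} {v} u~v with adj G (π₁ u) (π₁ v) | π₁ u ≟ π₁ v
  adj⁻ u~v  | true  | _        = inj₁ refl
  adj⁻ u~v  | false | yes same = inj₂ (same , u~v)
  adj⁻ ()   | false | no  _

  adj-fibre⁻ : IsSimple G → ∀ {u v} → π₁ u ≡ π₁ v → adj L u v ≡ true → adj H (π₂ u) (π₂ v) ≡ true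
  adj-fibre⁻ (_ , loopless) {u} {v} same u~v with adj⁻ u~v
  ... | inj₁ π₁u~π₁v rewrite same = ⊥-elim (true≢false (trans (sym π₁u~π₁v) (loopless (π₁ v))))
  ... | inj₂ (_ , π₂u~π₂v) = π₂u~π₂v

  nonneighbour-undominated : IsSimple G → ∀ {T x y y′} → y ≢ y′ → adj H y y′ ≡ false →
                             T ⊆ ⁅ ⟪ x , y ⟫ ⁆ → ¬ Dominates L T ⟪ x , y′ ⟫
  nonneighbour-undominated _ {x = x} {y} {y′} y≢y′ _ T⊆ (inj₁ xy′∈T) =
    y≢y′ (sym (combine-injectiveʳ x y′ x y (x∈⁅y⁆⇒x≡y ⟪ x , y ⟫ (T⊆ xy′∈T))))
  nonneighbour-undominated simple-G {x = x} {y} {y′} y≢y′ y≁y′ T⊆ (inj₂ (u , u∈T , u~xy′))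
    with x∈⁅y⁆⇒x≡y ⟪ x , y ⟫ (T⊆ u∈T)
  ... | refl = true≢false (trans (sym y~y′) y≁y′)
    where
    y~y′ : adj H y y′ ≡ true
    y~y′ = subst₂ (λ a b → adj H a b ≡ true) π₂-⟪⟫ π₂-⟪⟫
             (adj-fibre⁻ simple-G (trans π₁-⟪⟫ (sym π₁-⟪⟫)) u~xy′)

  ⊗-monoʳ-⊂ : ∀ {D A B x} → x ∈ D → B ⊂ A → D ⊗ B ⊂ D ⊗ A
  ⊗-monoʳ-⊂ {D} {A} {B} x∈D (B⊆A , y , y∈A , y∉B) =
    (λ u∈ → let π₁u∈D , π₂u∈B = ∈-⊗⁻ D B u∈ in
      subst (_∈ D ⊗ A) (⟪π₁,π₂⟫ refl) (∈-⊗⁺ π₁u∈D (B⊆A π₂u∈B))) ,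
    _ , ∈-⊗⁺ x∈D y∈A , λ xy∈ → y∉B (proj₂ (combine-∈-⊗⁻ D B xy∈))

  fibre-decomposition : ∀ {S x} → (∀ {u} → u ∈ S → π₁ u ≡ x) → S ≡ ⁅ x ⁆ ⊗ preimage ⟪ x ,_⟫ S
  fibre-decomposition {S} {x} in-fibre = ⊆-antisym
    (λ u∈S → subst (_∈ ⁅ x ⁆ ⊗ preimage ⟪ x ,_⟫ S) (⟪π₁,π₂⟫ (in-fibre u∈S))
      (∈-⊗⁺ (x∈⁅x⁆ x) (∈-preimage⁺ ⟪ x ,_⟫ (subst (_∈ S) (sym (⟪π₁,π₂⟫ (in-fibre u∈S))) u∈S))))
    (λ u∈ → let π₁u∈x , π₂u∈ = ∈-⊗⁻ ⁅ x ⁆ (preimage ⟪ x ,_⟫ S) u∈ in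
      subst (_∈ S) (⟪π₁,π₂⟫ (x∈⁅y⁆⇒x≡y x π₁u∈x)) (∈-preimage⁻ ⟪ x ,_⟫ π₂u∈))

  trace-dominating : IsSimple G → ∀ {T x} → (∀ {u} → u ∈ T → π₁ u ≡ x) → Dominating L T →
                     Dominating H (preimage ⟪ x ,_⟫ T)
  trace-dominating simple-G {T} {x} in-fibre dT y with dominates⁻ L (dT ⟪ x , y ⟫)
  ... | u , u∈T , u-xy =
    dominates-via H (∈-preimage⁺ ⟪ x ,_⟫ (subst (_∈ T) (sym (⟪π₁,π₂⟫ (in-fibre u∈T))) u∈T)) (lower u-xy)
    where
    lower : u ≡ ⟪ x , y ⟫ ⊎ adj L u ⟪ x , y ⟫ ≡ true → π₂ u ≡ y ⊎ adj H (π₂ u) y ≡ true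
    lower (inj₁ refl) = inj₁ π₂-⟪⟫
    lower (inj₂ u~xy) = inj₂ (subst (λ t → adj H (π₂ u) t ≡ true) π₂-⟪⟫
      (adj-fibre⁻ simple-G (trans (in-fibre u∈T) (sym π₁-⟪⟫)) u~xy))

  Covers : Subset (order L) → Subset (order G) → Set
  Covers S D = ∀ {x} → x ∈ D → ∃[ u ] (u ∈ S × π₁ u ≡ x)

  project : Subset (order L) → Subset (order G)
  project = image π₁

  project-covers : ∀ {S} → Covers S (project S)
  project-covers {S} = ∈-image⁻ π₁ S

  project-dominating : Fin (order H) → ∀ {S} → Dominating L S → Dominating G (project S)
  project-dominating y {S} dS x with dominates⁻ L (dS ⟪ x , y ⟫)
  ... | u , u∈S , u-xy = dominates-via G (∈-image⁺ π₁ u∈S) (lower u-xy)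
    where
    lower : u ≡ ⟪ x , y ⟫ ⊎ adj L u ⟪ x , y ⟫ ≡ true → π₁ u ≡ x ⊎ adj G (π₁ u) x ≡ true
    lower (inj₁ refl) = inj₁ π₁-⟪⟫
    lower (inj₂ u~xy) with adj⁻ u~xy
    ... | inj₁ π₁u~ = inj₂ (subst (λ t → adj G (π₁ u) t ≡ true) π₁-⟪⟫ π₁u~)
    ... | inj₂ (same , _) = inj₁ (trans same π₁-⟪⟫)

  module _ (complete-H : Complete H) where

    -- A vertex of G[H] dominates its whole fibre, so only the G-coordinates of S matter.
    covers-dominating : ∀ {S D} → Covers S D → Dominating G D → Dominating L S
    covers-dominating covers dD v with dominates⁻ G (dD (π₁ v))
    ... | x , x∈D , x-v with covers x∈D
    ...   | u , u∈S , π₁u≡x = dominates-via L u∈S (raise x-v)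
      where
      raise : x ≡ π₁ v ⊎ adj G x (π₁ v) ≡ true → u ≡ v ⊎ adj L u v ≡ true
      raise (inj₂ x~v) = inj₂ (adj-π₁ π₁u≡x x~v)
      raise (inj₁ refl) with u ≟ v
      ... | yes u≡v = inj₁ u≡v
      ... | no  u≢v = inj₂ (adj-π₂ π₁u≡x refl (complete-H _ _ (u≢v ∘ π-injective π₁u≡x)))

    minimal⇒π₁-injective : ∀ {S} → MinimalDominating L S → InjectiveOn π₁ S
    minimal⇒π₁-injective {S} (dS , minimal) {i} {j} i∈S j∈S π₁i≡π₁j with i ≟ j
    ... | yes i≡j = i≡j
    ... | no  i≢j = ⊥-elim (minimal (S - j) (x∈p⇒p-x⊂p j∈S)
                      (covers-dominating covers (project-dominating (π₂ i) dS)))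
      where
      covers : Covers (S - j) (project S)
      covers x∈ with project-covers x∈
      ... | u , u∈S , refl with u ≟ j
      ...   | yes refl = i , x∈p∧x≢y⇒x∈p-y i∈S i≢j , π₁i≡π₁j
      ...   | no  u≢j  = u , x∈p∧x≢y⇒x∈p-y u∈S u≢j , refl

    ∣project∣≡∣S∣ : ∀ {S} → MinimalDominating L S → ∣ project S ∣ ≡ ∣ S ∣
    ∣project∣≡∣S∣ {S} mS = ∣image∣≡∣p∣ π₁ S (minimal⇒π₁-injective mS)

    project-minimal : Fin (order H) → ∀ {S} → MinimalDominating L S → MinimalDominating G (project S)
    project-minimal y {S} (dS , minimal) = project-dominating y dS ,
      λ D (D⊆ , x , x∈ , x∉D) dD → minimal (S ∩ preimage π₁ D)
        (p∩q⊆p S (preimage π₁ D) , missing x∈ x∉D) (covers-dominating (covers D⊆) dD)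
      where
      covers : ∀ {D} → D ⊆ project S → Covers (S ∩ preimage π₁ D) D
      covers D⊆ x∈D with project-covers (D⊆ x∈D)
      ... | u , u∈S , refl = u , x∈p∩q⁺ (u∈S , ∈-preimage⁺ π₁ x∈D) , refl
      missing : ∀ {D x} → x ∈ project S → x ∉ D → ∃[ u ] (u ∈ S × u ∉ S ∩ preimage π₁ D)
      missing x∈ x∉D with project-covers x∈
      ... | u , u∈S , refl = u , u∈S , λ u∈ → x∉D (∈-preimage⁻ π₁ (proj₂ (x∈p∩q⁻ S _ u∈)))

    layer-minimal : ∀ y {D} → MinimalDominating G D → MinimalDominating L (D ⊗ ⁅ y ⁆)
    layer-minimal y {D} (dD , minimal) = covers-dominating covers dD ,
      λ T (T⊆ , i , i∈ , i∉T) dT → minimal (project T)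
        (projected T⊆ , π₁ i , proj₁ (∈-⊗⁻ D ⁅ y ⁆ i∈) , missing T⊆ i∈ i∉T) (project-dominating y dT)
      where
      covers : Covers (D ⊗ ⁅ y ⁆) D
      covers {x} x∈D = ⟪ x , y ⟫ , ∈-⊗⁺ x∈D (x∈⁅x⁆ y) , π₁-⟪⟫
      projected : ∀ {T} → T ⊆ D ⊗ ⁅ y ⁆ → project T ⊆ D
      projected {T} T⊆ x∈ with project-covers x∈
      ... | u , u∈T , refl = proj₁ (∈-⊗⁻ D ⁅ y ⁆ (T⊆ u∈T))
      missing : ∀ {T i} → T ⊆ D ⊗ ⁅ y ⁆ → i ∈ D ⊗ ⁅ y ⁆ → i ∉ T → π₁ i ∉ project T
      missing {T} T⊆ i∈ i∉T π₁i∈ with project-covers π₁i∈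
      ... | u , u∈T , π₁u≡π₁i = i∉T (subst (_∈ T) (π-injective π₁u≡π₁i π₂u≡π₂i) u∈T)
        where
        π₂u≡π₂i = x,y∈⁅z⁆⇒x≡y (proj₂ (∈-⊗⁻ D ⁅ y ⁆ (T⊆ u∈T))) (proj₂ (∈-⊗⁻ D ⁅ y ⁆ i∈))

    wellDominated⇔ : Fin (order H) → WellDominated G ⇔ WellDominated L
    wellDominated⇔ y = mk⇔
      (λ wdG S T mS mT → begin
        ∣ S ∣           ≡⟨ ∣project∣≡∣S∣ mS ⟨
        ∣ project S ∣   ≡⟨ wdG _ _ (project-minimal y mS) (project-minimal y mT) ⟩
        ∣ project T ∣   ≡⟨ ∣project∣≡∣S∣ mT ⟩
        ∣ T ∣           ∎)
      (λ wdL D E mD mE → begin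
        ∣ D ∣           ≡⟨ ∣p⊗⁅y⁆∣≡∣p∣ D y ⟨
        ∣ D ⊗ ⁅ y ⁆ ∣   ≡⟨ wdL _ _ (layer-minimal y mD) (layer-minimal y mE) ⟩
        ∣ E ⊗ ⁅ y ⁆ ∣   ≡⟨ ∣p⊗⁅y⁆∣≡∣p∣ E y ⟩
        ∣ E ∣           ∎)
      where open ≡-Reasoning

  module _ (complete-G : Complete G) where

    fibre-dominating : ∀ x {A} → Dominating H A → Dominating L (⁅ x ⁆ ⊗ A)
    fibre-dominating x {A} dA v with π₁ v ≟ x
    ... | no π₁v≢x = let b , b∈A = dominates⇒nonempty H (dA (π₂ v)) in
      inj₂ (⟪ x , b ⟫ , ∈-⊗⁺ (x∈⁅x⁆ x) b∈A , adj-π₁ π₁-⟪⟫ (complete-G x (π₁ v) (π₁v≢x ∘ sym)))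
    ... | yes π₁v≡x with dominates⁻ H (dA (π₂ v))
    ...   | b , b∈A , b-v = dominates-via L (∈-⊗⁺ (x∈⁅x⁆ x) b∈A) (raise b-v)
      where
      raise : b ≡ π₂ v ⊎ adj H b (π₂ v) ≡ true → ⟪ x , b ⟫ ≡ v ⊎ adj L ⟪ x , b ⟫ v ≡ true
      raise (inj₁ refl) = inj₁ (⟪π₁,π₂⟫ π₁v≡x)
      raise (inj₂ b~v)  = inj₂ (adj-π₂ (trans π₁-⟪⟫ (sym π₁v≡x)) π₂-⟪⟫ b~v)

    fibre-minimal⁺ : IsSimple G → ∀ x {A} → MinimalDominating H A → MinimalDominating L (⁅ x ⁆ ⊗ A)
    fibre-minimal⁺ simple-G x {A} (dA , minimal) = fibre-dominating x dA ,
      λ T (T⊆ , i , i∈ , i∉T) dT → minimal (preimage ⟪ x ,_⟫ T)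
        (traced T⊆ , π₂ i , proj₂ (∈-⊗⁻ ⁅ x ⁆ A i∈) , missing i∈ i∉T)
        (trace-dominating simple-G (λ u∈T → in-fibre (T⊆ u∈T)) dT)
      where
      in-fibre : ∀ {u} → u ∈ ⁅ x ⁆ ⊗ A → π₁ u ≡ x
      in-fibre u∈ = x∈⁅y⁆⇒x≡y x (proj₁ (∈-⊗⁻ ⁅ x ⁆ A u∈))
      traced : ∀ {T} → T ⊆ ⁅ x ⁆ ⊗ A → preimage ⟪ x ,_⟫ T ⊆ A
      traced T⊆ y∈ = proj₂ (combine-∈-⊗⁻ ⁅ x ⁆ A (T⊆ (∈-preimage⁻ ⟪ x ,_⟫ y∈)))
      missing : ∀ {T i} → i ∈ ⁅ x ⁆ ⊗ A → i ∉ T → π₂ i ∉ preimage ⟪ x ,_⟫ T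
      missing {T} i∈ i∉T π₂i∈ = i∉T (subst (_∈ T) (⟪π₁,π₂⟫ (in-fibre i∈)) (∈-preimage⁻ ⟪ x ,_⟫ π₂i∈))

    fibre-minimal⁻ : IsSimple G → ∀ x {A} → MinimalDominating L (⁅ x ⁆ ⊗ A) → MinimalDominating H A
    fibre-minimal⁻ simple-G x {A} (dF , minimal) =
      dominating-mono H traced (trace-dominating simple-G in-fibre dF) ,
      λ B B⊂A dB → minimal (⁅ x ⁆ ⊗ B) (⊗-monoʳ-⊂ (x∈⁅x⁆ x) B⊂A) (fibre-dominating x dB)
      where
      in-fibre : ∀ {u} → u ∈ ⁅ x ⁆ ⊗ A → π₁ u ≡ x
      in-fibre u∈ = x∈⁅y⁆⇒x≡y x (proj₁ (∈-⊗⁻ ⁅ x ⁆ A u∈))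
      traced : preimage ⟪ x ,_⟫ (⁅ x ⁆ ⊗ A) ⊆ A
      traced y∈ = proj₂ (combine-∈-⊗⁻ ⁅ x ⁆ A (∈-preimage⁻ ⟪ x ,_⟫ y∈))

    transversal-dominating : ∀ {i j} → π₁ i ≢ π₁ j → Dominating L (⁅ i ⁆ ∪ ⁅ j ⁆)
    transversal-dominating {i} {j} π₁i≢π₁j v with π₁ v ≟ π₁ i
    ... | yes π₁v≡π₁i = inj₂ (j , q⊆p∪q ⁅ i ⁆ ⁅ j ⁆ (x∈⁅x⁆ j) ,
          adj-π₁ refl (complete-G _ _ λ π₁j≡π₁v → π₁i≢π₁j (sym (trans π₁j≡π₁v π₁v≡π₁i))))
    ... | no  π₁v≢π₁i = inj₂ (i , p⊆p∪q ⁅ j ⁆ (x∈⁅x⁆ i) , adj-π₁ refl (complete-G _ _ (π₁v≢π₁i ∘ sym)))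

    minimal⇒transversal⊎fibre : Fin (order L) → ∀ {S} → MinimalDominating L S →
                                ∣ S ∣ ≡ 2 ⊎ ∃[ x ] ∃[ A ] (S ≡ ⁅ x ⁆ ⊗ A)
    minimal⇒transversal⊎fibre v {S} mS@(dS , _)
      with any? (λ i → any? λ j → i ∈? S ×-dec j ∈? S ×-dec ¬? (π₁ i ≟ π₁ j))
    ... | yes (i , j , i∈S , j∈S , π₁i≢π₁j) = inj₁ (begin
      ∣ S ∣              ≡⟨ cong ∣_∣ (⊆-antisym S⊆P P⊆S) ⟩
      ∣ ⁅ i ⁆ ∪ ⁅ j ⁆ ∣  ≡⟨ ∣⁅x⁆∪⁅y⁆∣≡2 (π₁i≢π₁j ∘ cong π₁) ⟩
      2                  ∎)
      where
      open ≡-Reasoning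
      P⊆S : ⁅ i ⁆ ∪ ⁅ j ⁆ ⊆ S
      P⊆S = ⁅x⁆∪⁅y⁆⊆p i∈S j∈S
      S⊆P : S ⊆ ⁅ i ⁆ ∪ ⁅ j ⁆
      S⊆P = minimalDominating-irreducible L mS P⊆S (transversal-dominating π₁i≢π₁j)
    ... | no one-fibre =
      let s , s∈S = dominates⇒nonempty L (dS v) in inj₂ (π₁ s , _ , fibre-decomposition (in-fibre s∈S))
      where
      in-fibre : ∀ {s u} → s ∈ S → u ∈ S → π₁ u ≡ π₁ s
      in-fibre {s} {u} s∈S u∈S with π₁ u ≟ π₁ s
      ... | yes π₁u≡π₁s = π₁u≡π₁s
      ... | no  π₁u≢π₁s = ⊥-elim (one-fibre (u , s , u∈S , s∈S , π₁u≢π₁s))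

    minimalDominatingSize-lex : IsSimple G → Fin (order L) → MinimalDominatingSize H 2 →
                                MinimalDominatingSize L 2
    minimalDominatingSize-lex simple-G v size S mS with minimal⇒transversal⊎fibre v mS
    ... | inj₁ ∣S∣≡2          = ∣S∣≡2
    ... | inj₂ (x , A , refl) = trans (∣⁅x⁆⊗q∣≡∣q∣ x A) (size A (fibre-minimal⁻ simple-G x mS))

    transversal-minimal : IsSimple G → ∀ {x x′ y y′} → x ≢ x′ → y ≢ y′ → adj H y y′ ≡ false →
                          MinimalDominating L (⁅ ⟪ x , y ⟫ ⁆ ∪ ⁅ ⟪ x′ , y ⟫ ⁆)
    transversal-minimal simple-G {x} {x′} {y} {y′} x≢x′ y≢y′ y≁y′ =
      transversal-dominating (λ e → x≢x′ (trans (sym π₁-⟪⟫) (trans e π₁-⟪⟫))) ,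
      λ T T⊂ dT → case ⊂⁅x⁆∪⁅y⁆ T⊂ of λ where
        (inj₁ T⊆) → nonneighbour-undominated simple-G y≢y′ y≁y′ T⊆ (dT ⟪ x , y′ ⟫)
        (inj₂ T⊆) → nonneighbour-undominated simple-G y≢y′ y≁y′ T⊆ (dT ⟪ x′ , y′ ⟫)

    minimalDominatingSize-fibre : IsSimple G → WellDominated L → ∀ {x x′ y y′} →
                                  x ≢ x′ → y ≢ y′ → adj H y y′ ≡ false → MinimalDominatingSize H 2
    minimalDominatingSize-fibre simple-G wdL {x} {x′} {y} x≢x′ y≢y′ y≁y′ A mA = begin
      ∣ A ∣                                 ≡⟨ ∣⁅x⁆⊗q∣≡∣q∣ x A ⟨
      ∣ ⁅ x ⁆ ⊗ A ∣                         ≡⟨ wdL _ _ (fibre-minimal⁺ simple-G x mA)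
                                                   (transversal-minimal simple-G x≢x′ y≢y′ y≁y′) ⟩
      ∣ ⁅ ⟪ x , y ⟫ ⁆ ∪ ⁅ ⟪ x′ , y ⟫ ⁆ ∣  ≡⟨ ∣⁅x⁆∪⁅y⁆∣≡2 (x≢x′ ∘ combine-injectiveˡ x y x′ y) ⟩
      2                                     ∎
      where open ≡-Reasoning

  ⊗-independent : ∀ {I J} → Independent G I → Independent H J → Independent L (I ⊗ J)
  ⊗-independent {I} {J} independent-I independent-J {u} {v} u∈ v∈
    with ∈-⊗⁻ I J u∈ | ∈-⊗⁻ I J v∈
  ... | π₁u∈I , π₂u∈J | π₁v∈I , π₂v∈J rewrite independent-I π₁u∈I π₁v∈I with π₁ u ≟ π₁ v
  ...   | yes _ = independent-J π₂u∈J π₂v∈J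
  ...   | no  _ = refl

  ⊗-dominating : ∀ {I J y} → Dominating G I → Dominating H J → y ∈ J → Dominating L (I ⊗ J)
  ⊗-dominating {I} {J} {y} dI dJ y∈J v with dI (π₁ v)
  ... | inj₂ (x , x∈I , x~v) = inj₂ (⟪ x , y ⟫ , ∈-⊗⁺ x∈I y∈J , adj-π₁ π₁-⟪⟫ x~v)
  ... | inj₁ π₁v∈I with dJ (π₂ v)
  ...   | inj₁ π₂v∈J = inj₁ (subst (_∈ I ⊗ J) (⟪π₁,π₂⟫ refl) (∈-⊗⁺ π₁v∈I π₂v∈J))
  ...   | inj₂ (b , b∈J , b~v) =
    inj₂ (⟪ π₁ v , b ⟫ , ∈-⊗⁺ π₁v∈I b∈J , adj-π₂ π₁-⟪⟫ π₂-⟪⟫ b~v)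

  exchange-dominating : ∀ {S a w z y₁ y₂} → Dominating L S → ⟪ a , y₁ ⟫ ∈ S → ⟪ w , y₁ ⟫ ∈ S →
                        adj G z a ≡ true → adj G z w ≡ true → y₁ ≢ y₂ →
                        Dominating L ((S - ⟪ a , y₂ ⟫ - ⟪ w , y₂ ⟫) ∪ ⁅ ⟪ z , y₁ ⟫ ⁆)
  exchange-dominating {S} {a} {w} {z} {y₁} {y₂} dS ay₁∈S wy₁∈S z~a z~w y₁≢y₂ v =
    via (dominates⁻ L (dS v))
    where
    X : Subset (order L)
    X = (S - ⟪ a , y₂ ⟫ - ⟪ w , y₂ ⟫) ∪ ⁅ ⟪ z , y₁ ⟫ ⁆
    layers-differ : ∀ {b c} → ⟪ b , y₁ ⟫ ≢ ⟪ c , y₂ ⟫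
    layers-differ {b} {c} e = y₁≢y₂ (combine-injectiveʳ b y₁ c y₂ e)
    kept : ∀ {u} → u ∈ S → u ≢ ⟪ a , y₂ ⟫ → u ≢ ⟪ w , y₂ ⟫ → u ∈ X
    kept u∈S u≢p u≢p′ = p⊆p∪q ⁅ ⟪ z , y₁ ⟫ ⁆ (x∈p∧x≢y⇒x∈p-y (x∈p∧x≢y⇒x∈p-y u∈S u≢p) u≢p′)
    -- What ⟪ b , y₂ ⟫ dominated, ⟪ b , y₁ ⟫ dominates outside the fibre of b and ⟪ z , y₁ ⟫ inside it.
    rescue : ∀ {b} → adj G z b ≡ true → ⟪ b , y₁ ⟫ ∈ S →
             ⟪ b , y₂ ⟫ ≡ v ⊎ adj L ⟪ b , y₂ ⟫ v ≡ true → Dominates L X v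
    rescue {b} z~b by₁∈S by₂-v with π₁ v ≟ b
    ... | yes refl = inj₂ (⟪ z , y₁ ⟫ , q⊆p∪q _ ⁅ ⟪ z , y₁ ⟫ ⁆ (x∈⁅x⁆ _) , adj-π₁ π₁-⟪⟫ z~b)
    ... | no π₁v≢b =
      inj₂ (⟪ b , y₁ ⟫ , kept by₁∈S layers-differ layers-differ , adj-π₁ π₁-⟪⟫ (across by₂-v))
      where
      across : ⟪ b , y₂ ⟫ ≡ v ⊎ adj L ⟪ b , y₂ ⟫ v ≡ true → adj G b (π₁ v) ≡ true
      across (inj₁ refl) = ⊥-elim (π₁v≢b π₁-⟪⟫)
      across (inj₂ by₂~v) with adj⁻ by₂~v
      ... | inj₁ π₁~π₁v     = subst (λ t → adj G t (π₁ v) ≡ true) π₁-⟪⟫ π₁~π₁v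
      ... | inj₂ (same , _) = ⊥-elim (π₁v≢b (trans (sym same) π₁-⟪⟫))
    via : ∃[ s ] (s ∈ S × (s ≡ v ⊎ adj L s v ≡ true)) → Dominates L X v
    via (s , s∈S , s-v) with s ≟ ⟪ a , y₂ ⟫ | s ≟ ⟪ w , y₂ ⟫
    ... | yes refl | _        = rescue z~a ay₁∈S s-v
    ... | no  _    | yes refl = rescue z~w wy₁∈S s-v
    ... | no  s≢p  | no  s≢p′ = dominates-via L (kept s∈S s≢p s≢p′) s-v

  no-induced-P₃ : IsSimple G → IsSimple H → WellDominated L → ∀ {y₁ y₂} → y₁ ≢ y₂ →
                  adj H y₁ y₂ ≡ false → ∀ {a z w} → adj G a z ≡ true → adj G z w ≡ true → a ≢ w →
                  ¬ adj G a w ≡ false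
  no-induced-P₃ simple-G simple-H wdL {y₁} {y₂} y₁≢y₂ y₁≁y₂ {a} {z} {w} a~z z~w a≢w a≁w
    with maximalIndependent-⊇ G simple-G (independent-⁅⁆∪⁅⁆ G simple-G a≁w)
       | maximalIndependent-⊇ H simple-H (independent-⁅⁆∪⁅⁆ H simple-H y₁≁y₂)
  ... | I , aw⊆I , independent-I , dI | J , y₁y₂⊆J , independent-J , dJ =
    <⇒≱ ∣X∣<∣S∣ (wellDominated⇒minimal-minimum L wdL mS dX)
    where
    a∈I : a ∈ I
    a∈I = aw⊆I (p⊆p∪q ⁅ w ⁆ (x∈⁅x⁆ a))
    w∈I : w ∈ I
    w∈I = aw⊆I (q⊆p∪q ⁅ a ⁆ ⁅ w ⁆ (x∈⁅x⁆ w))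
    y₁∈J : y₁ ∈ J
    y₁∈J = y₁y₂⊆J (p⊆p∪q ⁅ y₂ ⁆ (x∈⁅x⁆ y₁))
    y₂∈J : y₂ ∈ J
    y₂∈J = y₁y₂⊆J (q⊆p∪q ⁅ y₁ ⁆ ⁅ y₂ ⁆ (x∈⁅x⁆ y₂))
    dS : Dominating L (I ⊗ J)
    dS = ⊗-dominating dI dJ y₁∈J
    mS : MinimalDominating L (I ⊗ J)
    mS = independent-dominating⇒minimal L (⊗-independent independent-I independent-J) dS
    dX : Dominating L ((I ⊗ J - ⟪ a , y₂ ⟫ - ⟪ w , y₂ ⟫) ∪ ⁅ ⟪ z , y₁ ⟫ ⁆)
    dX = exchange-dominating dS (∈-⊗⁺ a∈I y₁∈J) (∈-⊗⁺ w∈I y₁∈J)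
           (trans (proj₁ simple-G z a) a~z) z~w y₁≢y₂
    z∉I : z ∉ I
    z∉I z∈I = true≢false (trans (sym a~z) (independent-I a∈I z∈I))
    ∣X∣<∣S∣ : ∣ (I ⊗ J - ⟪ a , y₂ ⟫ - ⟪ w , y₂ ⟫) ∪ ⁅ ⟪ z , y₁ ⟫ ⁆ ∣ < ∣ I ⊗ J ∣
    ∣X∣<∣S∣ = ∣p-x-y∪⁅z⁆∣<∣p∣ (∈-⊗⁺ a∈I y₂∈J) (∈-⊗⁺ w∈I y₂∈J)
      (λ e → a≢w (sym (combine-injectiveˡ w y₂ a y₂ e))) (z∉I ∘ proj₁ ∘ combine-∈-⊗⁻ I J)

  wellDominated⇒complete : IsSimple G → IsSimple H → WellDominated L → ∀ {y₁ y₂} → y₁ ≢ y₂ →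
                           adj H y₁ y₂ ≡ false → Connected G → Complete G
  wellDominated⇒complete simple-G simple-H wdL y₁≢y₂ y₁≁y₂ connected u v u≢v
    with adj G u v in u-v
  ... | true  = refl
  ... | false =
    let z , w , u~z , z~w , u≢w , u≁w = distance-two G connected u≢v u-v
    in ⊥-elim (no-induced-P₃ simple-G simple-H wdL y₁≢y₂ y₁≁y₂ u~z z~w u≢w u≁w)

theorem12 : (G H : Graph) → IsSimple G → IsSimple H → Connected G →
    2 ≤ order G → 2 ≤ order H →
    (WellDominated (lex G H) ⇔
      ((WellDominated G × Complete H) ⊎
       (Complete G × WellDominated H × DominationNumber H 2)))
theorem12 G H simple-G simple-H connected 2≤∣G∣ 2≤∣H∣
  with distinct-elements 2≤∣G∣ | distinct-elements 2≤∣H∣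
... | x₀ , x₁ , x₀≢x₁ | y₀ , _ = mk⇔ to from
  where
  open LexicographicProduct G H

  from : (WellDominated G × Complete H) ⊎ (Complete G × WellDominated H × DominationNumber H 2) →
         WellDominated L
  from (inj₁ (wdG , complete-H)) = Equivalence.to (wellDominated⇔ complete-H y₀) wdG
  from (inj₂ (complete-G , wdH , γ≡2)) = minimalDominatingSize⇒wellDominated L
    (minimalDominatingSize-lex complete-G simple-G ⟪ x₀ , y₀ ⟫
      (wellDominated⇒minimalDominatingSize H wdH γ≡2))

  to : WellDominated L →
       (WellDominated G × Complete H) ⊎ (Complete G × WellDominated H × DominationNumber H 2)
  to wdL with complete⊎nonadjacent H
  ... | inj₁ complete-H = inj₁ (Equivalence.from (wellDominated⇔ complete-H y₀) wdL , complete-H)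
  ... | inj₂ (y , y′ , y≢y′ , y≁y′) =
    inj₂ (complete-G , minimalDominatingSize⇒wellDominated H size₂ ,
          minimalDominatingSize⇒dominationNumber H size₂)
    where
    complete-G : Complete G
    complete-G = wellDominated⇒complete simple-G simple-H wdL y≢y′ y≁y′ connected
    size₂ : MinimalDominatingSize H 2
    size₂ = minimalDominatingSize-fibre complete-G simple-G wdL x₀≢x₁ y≢y′ y≁y′
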